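{- Let $G$ be a graph on $n\ge 2$ vertices such that for every integer $r\le 10\log^2 n$ and every vertex $x$ of $G$ we have $|B_r(x)|\le \frac{n}{5\log n}$. Then there is a set $S\subset V(G)$ with $|S|\le\frac{n}{5\log n}$ such that every connected component of $G-S$ has at most $\frac{n}{5\log n}$ vertices.
   Context: $\log$ denotes the natural logarithm. For a vertex $x$, $B_r(x)=\{v\in V(G): d_G(x,v)\le r\}$ is the ball of radius $r$ around $x$, where $d_G$ is the graph distance. -}

module Defs where

open import Data.Nat as ℕ using (ℕ; zero; suc)
open import Data.Integer using (+_)
open import Data.Rational using (ℚ; _/_; 0ℚ; 1ℚ; _+_; _*_; _≤_; _<_)
open import Data.Bool using (Bool; true; false; _∧_; _∨_)
open import Data.Fin using (Fin)
open import Data.Vec using (Vec; tabulate; lookup; foldr′)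
open import Data.Fin.Subset using (Subset; ⁅_⁆; _∪_; ∣_∣)
open import Data.Product using (Σ; _×_)
open import Relation.Nullary using (¬_)
open import Relation.Binary.PropositionalEquality using (_≡_)

record Graph (n : ℕ) : Set where
  field
    adj    : Fin n → Fin n → Bool
    sym    : ∀ u v → adj u v ≡ adj v u
    irrefl : ∀ v → adj v v ≡ false
open Graph public

anyV : ∀ {n} → (Fin n → Bool) → Bool
anyV f = foldr′ _∨_ false (tabulate f)

step : ∀ {n} → Graph n → Subset n → Subset n → Subset n
step G D A = A ∪ tabulate (λ v → lookup D v ∧ anyV (λ u → lookup A u ∧ adj G u v))

-- ballIn G D r x = { v : there is a walk of length ≤ r from x to v
--                        using only vertices of D }   (for x ∈ D)
ballIn : ∀ {n} → Graph n → Subset n → ℕ → Fin n → Subset n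
ballIn G D zero    x = ⁅ x ⁆
ballIn G D (suc r) x = step G D (ballIn G D r x)

ball : ∀ {n} → Graph n → ℕ → Fin n → Subset n
ball {n} G r x = ballIn G (tabulate (λ _ → true)) r x

-- The vertex set of the connected component of G - S containing v
-- (for v ∉ S): all vertices reachable from v by a walk avoiding S.
-- Walks of length n suffice, since a shortest path has < n edges.
component : ∀ {n} → Graph n → Subset n → Fin n → Subset n
component {n} G S v = ballIn G (Data.Fin.Subset.∁ S) n v

-- Natural logarithm comparisons, via the exponential series over ℚ.

ℕtoℚ : ℕ → ℚ
ℕtoℚ m = + m / 1

expTerm : ℕ → ℚ → ℚ
expTerm zero    q = 1ℚ
expTerm (suc i) q = expTerm i q * q * (+ 1 / suc i)

expPartial : ℕ → ℚ → ℚ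
expPartial zero    q = 0ℚ
expPartial (suc j) q = expPartial j q + expTerm j q

-- ExpLe q m  :⇔  e^q ≤ m   (for q ≥ 0: all partial sums are ≤ m)
ExpLe : ℚ → ℕ → Set
ExpLe q m = ∀ j → expPartial j q ≤ ℕtoℚ m

-- LeTenLogSq n r  :⇔  r ≤ 10 (log n)^2     (n ≥ 2)
-- Equivalently e^{√(r/10)} ≤ n, i.e. e^q ≤ n for every rational
-- q ≥ 0 with 10 q² ≤ r.
LeTenLogSq : ℕ → ℕ → Set
LeTenLogSq n r = ∀ (q : ℚ) → 0ℚ ≤ q → ℕtoℚ 10 * (q * q) ≤ ℕtoℚ r → ExpLe q n

-- LeNOverFiveLog n k  :⇔  k ≤ n / (5 log n)   (n ≥ 2, so log n > 0)
-- Equivalently ¬ (n < 5 k log n), and n < 5 k log n holds iff there is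
-- a rational p with n < 5 k p and e^p ≤ n (i.e. p ≤ log n).
LeNOverFiveLog : ℕ → ℕ → Set
LeNOverFiveLog n k =
  ¬ (Σ ℚ λ p → (ℕtoℚ n < ℕtoℚ (5 ℕ.* k) * p) × ExpLe p n)

module Submission where

-- Fix k with 2^k ≤ n < 2^{k+1}.  The comparisons with log n in Defs are phrased through the
-- exponential series; truncations of e^x are sub- and supermultiplicative (the binomial
-- theorem for the Cauchy product, proved from the Leibniz rule), so e^{0.69} ≤ 2 ≤ e^{0.7}
-- yield 0.69 k ≤ log n ≤ 0.7 (k+1).  If n ≤ 4k² ≤ 10 log² n, the set S = ∅ works, since each
-- component lies in a ball of radius n.  Otherwise k ≥ 7 and S is built greedily: in the
-- uncovered part, the ball around an uncovered vertex has a radius r ≤ 4k² + 4k whose sphere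
-- is thin, |sphere| ≤ 2 |ball| / (7(k+1)) (else the ball doubles every 4k steps and outgrows n);
-- the sphere goes into S and the ball becomes covered.  Thus 7(k+1) |S| ≤ 2n, which gives
-- |S| ≤ n/(5 log n), and each component of G − S lies in a ball of radius ≤ 4k² + 4k ≤ 10 log² n.

module RationalFacts where

  open import Defs using (ℕtoℚ)
  open import Data.Nat as ℕ using (ℕ; suc)
  open import Data.Integer as ℤ using (+_)
  import Data.Integer.Properties as ℤP
  open import Data.Rational
  open import Data.Rational.Properties
  import Data.Nat.Coprimality as C
  open import Data.Empty using (⊥)
  open import Relation.Binary.PropositionalEquality

  <⇒≱ : ∀ {p q} → p < q → q ≤ p → ⊥
  <⇒≱ p<q q≤p = <-irrefl refl (<-≤-trans p<q q≤p)

  -- ℕtoℚ m is the normalised fraction m/1, so its arithmetic reduces to ℤ.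
  ℕtoℚ-mkℚ : ∀ m → ℕtoℚ m ≡ mkℚ (+ m) 0 (C.sym (C.1-coprimeTo m))
  ℕtoℚ-mkℚ m = normalize-coprime (C.sym (C.1-coprimeTo m))

  ℕtoℚ-+ : ∀ a b → ℕtoℚ (a ℕ.+ b) ≡ ℕtoℚ a + ℕtoℚ b
  ℕtoℚ-+ a b rewrite ℕtoℚ-mkℚ a | ℕtoℚ-mkℚ b =
    sym (cong (_/ 1) (cong₂ ℤ._+_ (ℤP.*-identityʳ (+ a)) (ℤP.*-identityʳ (+ b))))

  ℕtoℚ-* : ∀ a b → ℕtoℚ (a ℕ.* b) ≡ ℕtoℚ a * ℕtoℚ b
  ℕtoℚ-* a b rewrite ℕtoℚ-mkℚ a | ℕtoℚ-mkℚ b = cong (_/ 1) (ℤP.pos-* a b)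

  ℕtoℚ-suc : ∀ a → ℕtoℚ (suc a) ≡ 1ℚ + ℕtoℚ a
  ℕtoℚ-suc = ℕtoℚ-+ 1

  ℕtoℚ-mono-≤ : ∀ {a b} → a ℕ.≤ b → ℕtoℚ a ≤ ℕtoℚ b
  ℕtoℚ-mono-≤ {a} {b} a≤b rewrite ℕtoℚ-mkℚ a | ℕtoℚ-mkℚ b =
    *≤* (subst₂ ℤ._≤_ (sym (ℤP.*-identityʳ (+ a))) (sym (ℤP.*-identityʳ (+ b))) (ℤ.+≤+ a≤b))

  ℕtoℚ-mono-< : ∀ {a b} → a ℕ.< b → ℕtoℚ a < ℕtoℚ b
  ℕtoℚ-mono-< {a} {b} a<b rewrite ℕtoℚ-mkℚ a | ℕtoℚ-mkℚ b =
    *<* (subst₂ ℤ._<_ (sym (ℤP.*-identityʳ (+ a))) (sym (ℤP.*-identityʳ (+ b))) (ℤ.+<+ a<b))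

  ℕtoℚ-nonNeg : ∀ a → 0ℚ ≤ ℕtoℚ a
  ℕtoℚ-nonNeg a = ℕtoℚ-mono-≤ {0} {a} ℕ.z≤n

  ℕtoℚ-suc-positive : ∀ m → Positive (ℕtoℚ (suc m))
  ℕtoℚ-suc-positive m = positive (ℕtoℚ-mono-< {0} {suc m} (ℕ.s≤s ℕ.z≤n))

  reciprocal-nonNeg : ∀ i → 0ℚ ≤ + 1 / suc i
  reciprocal-nonNeg i = nonNegative⁻¹ _ {{normalize-nonNeg 1 (suc i)}}

  ℕtoℚ-*-reciprocal : ∀ i → ℕtoℚ (suc i) * (+ 1 / suc i) ≡ 1ℚ
  ℕtoℚ-*-reciprocal i =
    trans (cong₂ _*_ (ℕtoℚ-mkℚ (suc i)) (normalize-coprime (C.1-coprimeTo (suc i))))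
          (*-inverseʳ (mkℚ (+ suc i) 0 (C.sym (C.1-coprimeTo (suc i)))))

  *-nonNeg : ∀ {a b} → 0ℚ ≤ a → 0ℚ ≤ b → 0ℚ ≤ a * b
  *-nonNeg {a} {b} 0≤a 0≤b =
    nonNegative⁻¹ _ {{nonNeg*nonNeg⇒nonNeg a {{nonNegative 0≤a}} b {{nonNegative 0≤b}}}}

  *-mono-≤-nonNeg : ∀ {a a′ b b′} → 0ℚ ≤ a → a ≤ a′ → 0ℚ ≤ b → b ≤ b′ → a * b ≤ a′ * b′
  *-mono-≤-nonNeg {a} {a′} {b} {b′} 0≤a a≤a′ 0≤b b≤b′ =
    ≤-trans (*-monoʳ-≤-nonNeg b {{nonNegative 0≤b}} a≤a′)
            (*-monoˡ-≤-nonNeg a′ {{nonNegative (≤-trans 0≤a a≤a′)}} b≤b′)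

module ExponentialSeries where

  open import Defs using (ℕtoℚ; expTerm; expPartial)
  open RationalFacts
  open import Data.Nat as ℕ using (ℕ; zero; suc)
  open import Data.Integer using (+_)
  open import Data.Rational
  open import Data.Rational.Properties
  open import Data.Rational.Solver
  open import Relation.Binary.PropositionalEquality
  open +-*-Solver

  Seq : Set
  Seq = ℕ → ℚ

  shift : Seq → Seq
  shift f a = f (suc a)

  -- Cauchy product: conv f g m = Σ_{a+b=m} f a · g b.
  conv : Seq → Seq → Seq
  conv f g zero    = f 0 * g 0
  conv f g (suc m) = f 0 * g (suc m) + conv (shift f) g m

  conv-cong : ∀ {f f′ g g′} m → (∀ a → f a ≡ f′ a) → (∀ b → g b ≡ g′ b) →
              conv f g m ≡ conv f′ g′ m
  conv-cong zero    ef eg = cong₂ _*_ (ef 0) (eg 0)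
  conv-cong (suc m) ef eg =
    cong₂ _+_ (cong₂ _*_ (ef 0) (eg (suc m))) (conv-cong m (λ a → ef (suc a)) eg)

  conv-+ˡ : ∀ f h g m → conv (λ a → f a + h a) g m ≡ conv f g m + conv h g m
  conv-+ˡ f h g zero    = *-distribʳ-+ (g 0) (f 0) (h 0)
  conv-+ˡ f h g (suc m) = begin
    (f 0 + h 0) * g (suc m) + conv (λ a → f (suc a) + h (suc a)) g m
      ≡⟨ cong (_+_ ((f 0 + h 0) * g (suc m))) (conv-+ˡ (shift f) (shift h) g m) ⟩
    (f 0 + h 0) * g (suc m) + (conv (shift f) g m + conv (shift h) g m)
      ≡⟨ solve 5 (λ a b c u v → (a :+ b) :* c :+ (u :+ v) := (a :* c :+ u) :+ (b :* c :+ v))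
               refl (f 0) (h 0) (g (suc m)) (conv (shift f) g m) (conv (shift h) g m) ⟩
    (f 0 * g (suc m) + conv (shift f) g m) + (h 0 * g (suc m) + conv (shift h) g m) ∎
    where open ≡-Reasoning

  conv-scaleˡ : ∀ x f g m → conv (λ a → x * f a) g m ≡ x * conv f g m
  conv-scaleˡ x f g zero    = *-assoc x (f 0) (g 0)
  conv-scaleˡ x f g (suc m) = begin
    x * f 0 * g (suc m) + conv (λ a → x * f (suc a)) g m
      ≡⟨ cong (_+_ (x * f 0 * g (suc m))) (conv-scaleˡ x (shift f) g m) ⟩
    x * f 0 * g (suc m) + x * conv (shift f) g m
      ≡⟨ solve 4 (λ x a b c → x :* a :* b :+ x :* c := x :* (a :* b :+ c))
               refl x (f 0) (g (suc m)) (conv (shift f) g m) ⟩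
    x * (f 0 * g (suc m) + conv (shift f) g m) ∎
    where open ≡-Reasoning

  conv-scaleʳ : ∀ y f g m → conv f (λ b → y * g b) m ≡ y * conv f g m
  conv-scaleʳ y f g zero    = solve 3 (λ y a b → a :* (y :* b) := y :* (a :* b)) refl y (f 0) (g 0)
  conv-scaleʳ y f g (suc m) = begin
    f 0 * (y * g (suc m)) + conv (shift f) (λ b → y * g b) m
      ≡⟨ cong (_+_ (f 0 * (y * g (suc m)))) (conv-scaleʳ y (shift f) g m) ⟩
    f 0 * (y * g (suc m)) + y * conv (shift f) g m
      ≡⟨ solve 4 (λ y a b c → a :* (y :* b) :+ y :* c := y :* (a :* b :+ c))
               refl y (f 0) (g (suc m)) (conv (shift f) g m) ⟩
    y * (f 0 * g (suc m) + conv (shift f) g m) ∎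
    where open ≡-Reasoning

  deriv : Seq → Seq
  deriv f m = ℕtoℚ (suc m) * f (suc m)

  deriv-shift : ∀ f a → deriv f (suc a) ≡ deriv (shift f) a + f (suc (suc a))
  deriv-shift f a = begin
    ℕtoℚ (suc (suc a)) * f (suc (suc a))          ≡⟨ cong (_* f (suc (suc a))) (ℕtoℚ-suc (suc a)) ⟩
    (1ℚ + ℕtoℚ (suc a)) * f (suc (suc a))         ≡⟨ solve 2 (λ n c → (con 1ℚ :+ n) :* c := n :* c :+ c)
                                                            refl (ℕtoℚ (suc a)) (f (suc (suc a))) ⟩
    ℕtoℚ (suc a) * f (suc (suc a)) + f (suc (suc a)) ∎
    where open ≡-Reasoning

  leibniz : ∀ m f g → conv (deriv f) g m + conv f (deriv g) m ≡ deriv (conv f g) m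
  leibniz zero f g =
    solve 4 (λ a b c d → con 1ℚ :* a :* b :+ c :* (con 1ℚ :* d) := con 1ℚ :* (c :* d :+ a :* b))
          refl (f 1) (g 0) (f 0) (g 1)
  leibniz (suc m) f g = begin
    deriv f 0 * g (suc m) + conv (shift (deriv f)) g m + (f 0 * deriv g (suc m) + conv f₁ (deriv g) m)
      ≡⟨ cong (λ z → deriv f 0 * g (suc m) + z + (f 0 * deriv g (suc m) + conv f₁ (deriv g) m))
              (trans (conv-cong m (deriv-shift f) (λ _ → refl)) (conv-+ˡ (deriv f₁) f₂ g m)) ⟩
    deriv f 0 * g (suc m) + (conv (deriv f₁) g m + conv f₂ g m) + (f 0 * deriv g (suc m) + conv f₁ (deriv g) m)
      ≡⟨ solve 5 (λ a b c d u → a :+ (b :+ c) :+ (d :+ u) := (a :+ c :+ d) :+ (b :+ u))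
               refl (deriv f 0 * g (suc m)) (conv (deriv f₁) g m) (conv f₂ g m)
                    (f 0 * deriv g (suc m)) (conv f₁ (deriv g) m) ⟩
    (deriv f 0 * g (suc m) + conv f₂ g m + f 0 * deriv g (suc m)) + (conv (deriv f₁) g m + conv f₁ (deriv g) m)
      ≡⟨ cong (_+_ (deriv f 0 * g (suc m) + conv f₂ g m + f 0 * deriv g (suc m))) (leibniz m f₁ g) ⟩
    (deriv f 0 * g (suc m) + conv f₂ g m + f 0 * deriv g (suc m)) + ℕtoℚ (suc m) * conv f₁ g (suc m)
      ≡⟨ cong (λ N → (deriv f 0 * g (suc m) + conv f₂ g m + f 0 * (N * g (suc (suc m))))
                     + ℕtoℚ (suc m) * conv f₁ g (suc m)) (ℕtoℚ-suc (suc m)) ⟩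
    (1ℚ * f 1 * g (suc m) + conv f₂ g m + f 0 * ((1ℚ + ℕtoℚ (suc m)) * g (suc (suc m))))
      + ℕtoℚ (suc m) * (f 1 * g (suc m) + conv f₂ g m)
      ≡⟨ solve 6 (λ M a b c d e → (con 1ℚ :* a :* b :+ c :+ d :* ((con 1ℚ :+ M) :* e)) :+ M :* (a :* b :+ c)
                                 := (con 1ℚ :+ M) :* (d :* e :+ (a :* b :+ c)))
               refl (ℕtoℚ (suc m)) (f 1) (g (suc m)) (conv f₂ g m) (f 0) (g (suc (suc m))) ⟩
    (1ℚ + ℕtoℚ (suc m)) * (f 0 * g (suc (suc m)) + conv f₁ g (suc m))
      ≡⟨ cong (_* (f 0 * g (suc (suc m)) + conv f₁ g (suc m))) (sym (ℕtoℚ-suc (suc m))) ⟩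
    deriv (conv f g) (suc m) ∎
    where
    open ≡-Reasoning
    f₁ = shift f
    f₂ = shift f₁

  expTerm-deriv : ∀ m z → deriv (λ i → expTerm i z) m ≡ expTerm m z * z
  expTerm-deriv m z = begin
    ℕtoℚ (suc m) * (expTerm m z * z * (+ 1 / suc m))
      ≡⟨ solve 3 (λ a b c → a :* (b :* c) := b :* (a :* c)) refl (ℕtoℚ (suc m)) (expTerm m z * z) (+ 1 / suc m) ⟩
    expTerm m z * z * (ℕtoℚ (suc m) * (+ 1 / suc m))
      ≡⟨ cong (expTerm m z * z *_) (ℕtoℚ-*-reciprocal m) ⟩
    expTerm m z * z * 1ℚ
      ≡⟨ *-identityʳ _ ⟩
    expTerm m z * z ∎
    where open ≡-Reasoning

  ℕtoℚ-suc-*-cancel : ∀ m {a b} → ℕtoℚ (suc m) * a ≡ ℕtoℚ (suc m) * b → a ≡ b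
  ℕtoℚ-suc-*-cancel m {a} {b} eq = begin
    a                                  ≡⟨ sym (unscale a) ⟩
    (ℕtoℚ (suc m) * a) * (+ 1 / suc m) ≡⟨ cong (_* (+ 1 / suc m)) eq ⟩
    (ℕtoℚ (suc m) * b) * (+ 1 / suc m) ≡⟨ unscale b ⟩
    b                                  ∎
    where
    open ≡-Reasoning
    unscale : ∀ c → (ℕtoℚ (suc m) * c) * (+ 1 / suc m) ≡ c
    unscale c = begin
      (ℕtoℚ (suc m) * c) * (+ 1 / suc m) ≡⟨ solve 3 (λ n c r → (n :* c) :* r := c :* (n :* r)) refl
                                                      (ℕtoℚ (suc m)) c (+ 1 / suc m) ⟩
      c * (ℕtoℚ (suc m) * (+ 1 / suc m)) ≡⟨ cong (c *_) (ℕtoℚ-*-reciprocal m) ⟩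
      c * 1ℚ                             ≡⟨ *-identityʳ c ⟩
      c                                  ∎

  -- Binomial theorem for the exponential coefficients:
  -- Σ_{a+b=m} x^a/a! · y^b/b! = (x+y)^m/m!.  Both sides satisfy c′ = (x+y)·c with c 0 = 1.
  expTerm-+ : ∀ m x y → conv (λ a → expTerm a x) (λ b → expTerm b y) m ≡ expTerm m (x + y)
  expTerm-+ zero    x y = refl
  expTerm-+ (suc m) x y = ℕtoℚ-suc-*-cancel m (begin
    deriv (conv eˣ eʸ) m
      ≡⟨ sym (leibniz m eˣ eʸ) ⟩
    conv (deriv eˣ) eʸ m + conv eˣ (deriv eʸ) m
      ≡⟨ cong₂ _+_ (conv-cong m (λ a → trans (expTerm-deriv a x) (*-comm (eˣ a) x)) (λ _ → refl))
                   (conv-cong m (λ _ → refl) (λ b → trans (expTerm-deriv b y) (*-comm (eʸ b) y))) ⟩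
    conv (λ a → x * eˣ a) eʸ m + conv eˣ (λ b → y * eʸ b) m
      ≡⟨ cong₂ _+_ (conv-scaleˡ x eˣ eʸ m) (conv-scaleʳ y eˣ eʸ m) ⟩
    x * conv eˣ eʸ m + y * conv eˣ eʸ m
      ≡⟨ sym (*-distribʳ-+ (conv eˣ eʸ m) x y) ⟩
    (x + y) * conv eˣ eʸ m
      ≡⟨ cong ((x + y) *_) (expTerm-+ m x y) ⟩
    (x + y) * expTerm m (x + y)
      ≡⟨ *-comm (x + y) _ ⟩
    expTerm m (x + y) * (x + y)
      ≡⟨ sym (expTerm-deriv m (x + y)) ⟩
    deriv (λ i → expTerm i (x + y)) m ∎)
    where
    open ≡-Reasoning
    eˣ eʸ : Seq
    eˣ a = expTerm a x
    eʸ b = expTerm b y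

  -- Finite sums Σ_{i<j} h i, peeling off the first term as conv does.
  sum : ℕ → Seq → ℚ
  sum zero    h = 0ℚ
  sum (suc j) h = h 0 + sum j (shift h)

  sum-snoc : ∀ j h → sum (suc j) h ≡ sum j h + h j
  sum-snoc zero    h = trans (+-identityʳ (h 0)) (sym (+-identityˡ (h 0)))
  sum-snoc (suc j) h = trans (cong (_+_ (h 0)) (sum-snoc j (shift h))) (sym (+-assoc (h 0) _ _))

  sum-cong : ∀ j {h h′} → (∀ a → h a ≡ h′ a) → sum j h ≡ sum j h′
  sum-cong zero    e = refl
  sum-cong (suc j) e = cong₂ _+_ (e 0) (sum-cong j (λ a → e (suc a)))

  sum-+ : ∀ j h₁ h₂ → sum j (λ m → h₁ m + h₂ m) ≡ sum j h₁ + sum j h₂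
  sum-+ zero    h₁ h₂ = refl
  sum-+ (suc j) h₁ h₂ =
    trans (cong (_+_ (h₁ 0 + h₂ 0)) (sum-+ j (shift h₁) (shift h₂)))
          (solve 4 (λ a b c d → a :+ b :+ (c :+ d) := a :+ c :+ (b :+ d))
                 refl (h₁ 0) (h₂ 0) (sum j (shift h₁)) (sum j (shift h₂)))

  sum-scale : ∀ j x h → sum j (λ m → x * h m) ≡ x * sum j h
  sum-scale zero    x h = sym (*-zeroʳ x)
  sum-scale (suc j) x h =
    trans (cong (_+_ (x * h 0)) (sum-scale j x (shift h))) (sym (*-distribˡ-+ x (h 0) _))

  NonNeg : Seq → Set
  NonNeg h = ∀ a → 0ℚ ≤ h a

  sum-nonNeg : ∀ j {h} → NonNeg h → 0ℚ ≤ sum j h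
  sum-nonNeg zero    h≥0 = ≤-refl
  sum-nonNeg (suc j) h≥0 = +-mono-≤ (h≥0 0) (sum-nonNeg j (λ a → h≥0 (suc a)))

  sum-grows-suc : ∀ j {h} → NonNeg h → sum j h ≤ sum (suc j) h
  sum-grows-suc j {h} h≥0 =
    subst₂ _≤_ (+-identityʳ (sum j h)) (sym (sum-snoc j h)) (+-monoʳ-≤ (sum j h) (h≥0 j))

  sum-grows : ∀ j t {h} → NonNeg h → sum j h ≤ sum (t ℕ.+ j) h
  sum-grows j zero    h≥0 = ≤-refl
  sum-grows j (suc t) h≥0 = ≤-trans (sum-grows j t h≥0) (sum-grows-suc (t ℕ.+ j) h≥0)

  conv-nonNeg : ∀ m {f g} → NonNeg f → NonNeg g → 0ℚ ≤ conv f g m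
  conv-nonNeg zero    f≥0 g≥0 = *-nonNeg (f≥0 0) (g≥0 0)
  conv-nonNeg (suc m) f≥0 g≥0 =
    +-mono-≤ (*-nonNeg (f≥0 0) (g≥0 (suc m))) (conv-nonNeg m (λ a → f≥0 (suc a)) g≥0)

  sum-conv-split : ∀ j f g → sum (suc j) (conv f g) ≡ f 0 * sum (suc j) g + sum j (conv (shift f) g)
  sum-conv-split j f g = begin
    f 0 * g 0 + sum j (λ m → f 0 * g (suc m) + conv (shift f) g m)
      ≡⟨ cong (_+_ (f 0 * g 0)) (sum-+ j (λ m → f 0 * g (suc m)) (conv (shift f) g)) ⟩
    f 0 * g 0 + (sum j (λ m → f 0 * g (suc m)) + sum j (conv (shift f) g))
      ≡⟨ cong (λ z → f 0 * g 0 + (z + sum j (conv (shift f) g))) (sum-scale j (f 0) (shift g)) ⟩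
    f 0 * g 0 + (f 0 * sum j (shift g) + sum j (conv (shift f) g))
      ≡⟨ solve 4 (λ a b c d → a :* b :+ (a :* c :+ d) := a :* (b :+ c) :+ d)
               refl (f 0) (g 0) (sum j (shift g)) (sum j (conv (shift f) g)) ⟩
    f 0 * (g 0 + sum j (shift g)) + sum j (conv (shift f) g) ∎
    where open ≡-Reasoning

  sum-conv-≤ : ∀ j f g → NonNeg f → NonNeg g → sum j (conv f g) ≤ sum j f * sum j g
  sum-conv-≤ zero    f g f≥0 g≥0 = ≤-refl
  sum-conv-≤ (suc j) f g f≥0 g≥0 = begin
    sum (suc j) (conv f g)
      ≡⟨ sum-conv-split j f g ⟩
    f 0 * sum (suc j) g + sum j (conv (shift f) g)
      ≤⟨ +-monoʳ-≤ (f 0 * sum (suc j) g) (sum-conv-≤ j (shift f) g (λ a → f≥0 (suc a)) g≥0) ⟩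
    f 0 * sum (suc j) g + sum j (shift f) * sum j g
      ≤⟨ +-monoʳ-≤ (f 0 * sum (suc j) g)
           (*-mono-≤-nonNeg (sum-nonNeg j (λ a → f≥0 (suc a))) ≤-refl (sum-nonNeg j g≥0) (sum-grows-suc j g≥0)) ⟩
    f 0 * sum (suc j) g + sum j (shift f) * sum (suc j) g
      ≡⟨ sym (*-distribʳ-+ (sum (suc j) g) (f 0) (sum j (shift f))) ⟩
    (f 0 + sum j (shift f)) * sum (suc j) g ∎
    where open ≤-Reasoning

  ≤-sum-conv : ∀ j k f g → NonNeg f → NonNeg g → sum j f * sum k g ≤ sum (j ℕ.+ k) (conv f g)
  ≤-sum-conv zero    k f g f≥0 g≥0 =
    subst (_≤ sum k (conv f g)) (sym (*-zeroˡ (sum k g))) (sum-nonNeg k (λ m → conv-nonNeg m f≥0 g≥0))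
  ≤-sum-conv (suc j) k f g f≥0 g≥0 = begin
    (f 0 + sum j (shift f)) * sum k g
      ≡⟨ *-distribʳ-+ (sum k g) (f 0) (sum j (shift f)) ⟩
    f 0 * sum k g + sum j (shift f) * sum k g
      ≤⟨ +-mono-≤ (*-mono-≤-nonNeg (f≥0 0) ≤-refl (sum-nonNeg k g≥0) (sum-grows k (suc j) g≥0))
                  (≤-sum-conv j k (shift f) g (λ a → f≥0 (suc a)) g≥0) ⟩
    f 0 * sum (suc (j ℕ.+ k)) g + sum (j ℕ.+ k) (conv (shift f) g)
      ≡⟨ sym (sum-conv-split (j ℕ.+ k) f g) ⟩
    sum (suc (j ℕ.+ k)) (conv f g) ∎
    where open ≤-Reasoning

  expPartial≡sum : ∀ j x → expPartial j x ≡ sum j (λ i → expTerm i x)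
  expPartial≡sum zero    x = refl
  expPartial≡sum (suc j) x =
    trans (cong (_+ expTerm j x) (expPartial≡sum j x)) (sym (sum-snoc j (λ i → expTerm i x)))

  expTerm-nonNeg : ∀ i {x} → 0ℚ ≤ x → 0ℚ ≤ expTerm i x
  expTerm-nonNeg zero    0≤x = ≤ᵇ⇒≤ _
  expTerm-nonNeg (suc i) 0≤x = *-nonNeg (*-nonNeg (expTerm-nonNeg i 0≤x) 0≤x) (reciprocal-nonNeg i)

  expPartial-nonNeg : ∀ j {x} → 0ℚ ≤ x → 0ℚ ≤ expPartial j x
  expPartial-nonNeg zero    0≤x = ≤-refl
  expPartial-nonNeg (suc j) 0≤x = +-mono-≤ (expPartial-nonNeg j 0≤x) (expTerm-nonNeg j 0≤x)

  expTerm-mono : ∀ i {x y} → 0ℚ ≤ x → x ≤ y → expTerm i x ≤ expTerm i y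
  expTerm-mono zero    0≤x x≤y = ≤-refl
  expTerm-mono (suc i) 0≤x x≤y =
    *-mono-≤-nonNeg (*-nonNeg (expTerm-nonNeg i 0≤x) 0≤x)
                    (*-mono-≤-nonNeg (expTerm-nonNeg i 0≤x) (expTerm-mono i 0≤x x≤y) 0≤x x≤y)
                    (reciprocal-nonNeg i) ≤-refl

  expPartial-mono : ∀ j {x y} → 0ℚ ≤ x → x ≤ y → expPartial j x ≤ expPartial j y
  expPartial-mono zero    0≤x x≤y = ≤-refl
  expPartial-mono (suc j) 0≤x x≤y = +-mono-≤ (expPartial-mono j 0≤x x≤y) (expTerm-mono j 0≤x x≤y)

  expPartial-grows : ∀ j t {x} → 0ℚ ≤ x → expPartial j x ≤ expPartial (t ℕ.+ j) x
  expPartial-grows j t {x} 0≤x =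
    subst₂ _≤_ (sym (expPartial≡sum j x)) (sym (expPartial≡sum (t ℕ.+ j) x))
           (sum-grows j t (λ i → expTerm-nonNeg i 0≤x))

  expPartial-submultiplicative : ∀ j {x y} → 0ℚ ≤ x → 0ℚ ≤ y →
                                 expPartial j (x + y) ≤ expPartial j x * expPartial j y
  expPartial-submultiplicative j {x} {y} 0≤x 0≤y = begin
    expPartial j (x + y)                                  ≡⟨ expPartial≡sum j (x + y) ⟩
    sum j (λ i → expTerm i (x + y))                       ≡⟨ sym (sum-cong j (λ i → expTerm-+ i x y)) ⟩
    sum j (conv (λ a → expTerm a x) (λ b → expTerm b y))  ≤⟨ sum-conv-≤ j _ _ (λ a → expTerm-nonNeg a 0≤x)
                                                                               (λ b → expTerm-nonNeg b 0≤y) ⟩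
    sum j (λ a → expTerm a x) * sum j (λ b → expTerm b y) ≡⟨ sym (cong₂ _*_ (expPartial≡sum j x) (expPartial≡sum j y)) ⟩
    expPartial j x * expPartial j y                       ∎
    where open ≤-Reasoning

  expPartial-supermultiplicative : ∀ j k {x y} → 0ℚ ≤ x → 0ℚ ≤ y →
                                   expPartial j x * expPartial k y ≤ expPartial (j ℕ.+ k) (x + y)
  expPartial-supermultiplicative j k {x} {y} 0≤x 0≤y = begin
    expPartial j x * expPartial k y                                ≡⟨ cong₂ _*_ (expPartial≡sum j x) (expPartial≡sum k y) ⟩
    sum j (λ a → expTerm a x) * sum k (λ b → expTerm b y)          ≤⟨ ≤-sum-conv j k _ _ (λ a → expTerm-nonNeg a 0≤x)
                                                                                        (λ b → expTerm-nonNeg b 0≤y) ⟩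
    sum (j ℕ.+ k) (conv (λ a → expTerm a x) (λ b → expTerm b y))   ≡⟨ sum-cong (j ℕ.+ k) (λ i → expTerm-+ i x y) ⟩
    sum (j ℕ.+ k) (λ i → expTerm i (x + y))                        ≡⟨ sym (expPartial≡sum (j ℕ.+ k) (x + y)) ⟩
    expPartial (j ℕ.+ k) (x + y)                                   ∎
    where open ≤-Reasoning

module LogarithmBounds where

  open import Defs using (ℕtoℚ; expTerm; expPartial; ExpLe)
  open RationalFacts
  open ExponentialSeries
  open import Data.Nat as ℕ using (ℕ; zero; suc)
  import Data.Nat.Properties as ℕP
  open import Data.Integer using (+_)
  open import Data.Rational
  open import Data.Rational.Properties
  open import Data.Rational.Solver
  open import Data.Empty using (⊥-elim)
  open import Relation.Nullary using (yes; no)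
  open import Relation.Binary.PropositionalEquality
  open +-*-Solver

  -- Rational brackets around log 2:  0.69 ≤ log 2 ≤ 0.7.
  c69 c70 : ℚ
  c69 = + 69 / 100
  c70 = + 7 / 10

  c69-nonNeg : 0ℚ ≤ c69
  c69-nonNeg = ≤ᵇ⇒≤ _

  c69≤1 : c69 ≤ 1ℚ
  c69≤1 = ≤ᵇ⇒≤ _

  c70-nonNeg : 0ℚ ≤ c70
  c70-nonNeg = ≤ᵇ⇒≤ _

  exp-c69-certificate : expPartial 6 c69 + ℕtoℚ 2 * expTerm 6 c69 ≤ ℕtoℚ 2
  exp-c69-certificate = ≤ᵇ⇒≤ _

  exp-c70-certificate : ℕtoℚ 2 ≤ expPartial 6 c70
  exp-c70-certificate = ≤ᵇ⇒≤ _

  expTerm-halves : ∀ i {x} → 1 ℕ.≤ i → 0ℚ ≤ x → x ≤ 1ℚ → ℕtoℚ 2 * expTerm (suc i) x ≤ expTerm i x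
  expTerm-halves i {x} 1≤i 0≤x x≤1 = begin
    ℕtoℚ 2 * (expTerm i x * x * w)
      ≡⟨ solve 4 (λ t a b c → t :* (a :* b :* c) := a :* (b :* (t :* c))) refl (ℕtoℚ 2) (expTerm i x) x w ⟩
    expTerm i x * (x * (ℕtoℚ 2 * w))
      ≤⟨ *-mono-≤-nonNeg (expTerm-nonNeg i 0≤x) ≤-refl (*-nonNeg 0≤x 0≤2w) (*-mono-≤-nonNeg 0≤x x≤1 0≤2w 2w≤1) ⟩
    expTerm i x * 1ℚ
      ≡⟨ *-identityʳ _ ⟩
    expTerm i x ∎
    where
    open ≤-Reasoning
    w = + 1 / suc i
    0≤2w : 0ℚ ≤ ℕtoℚ 2 * w
    0≤2w = *-nonNeg (ℕtoℚ-nonNeg 2) (reciprocal-nonNeg i)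
    2w≤1 : ℕtoℚ 2 * w ≤ 1ℚ
    2w≤1 = subst (ℕtoℚ 2 * w ≤_) (ℕtoℚ-*-reciprocal i)
             (*-monoʳ-≤-nonNeg w {{nonNegative (reciprocal-nonNeg i)}} (ℕtoℚ-mono-≤ (ℕ.s≤s 1≤i)))

  -- Consequently P_i(x) + 2 t_i(x) is nonincreasing from i = 6 on, bounding every tail.
  tail-bound : ∀ t {x} → 0ℚ ≤ x → x ≤ 1ℚ →
    expPartial (t ℕ.+ 6) x + ℕtoℚ 2 * expTerm (t ℕ.+ 6) x ≤ expPartial 6 x + ℕtoℚ 2 * expTerm 6 x
  tail-bound zero    0≤x x≤1 = ≤-refl
  tail-bound (suc t) {x} 0≤x x≤1 = ≤-trans one-step (tail-bound t 0≤x x≤1)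
    where
    i = t ℕ.+ 6
    one-step : expPartial i x + expTerm i x + ℕtoℚ 2 * expTerm (suc i) x ≤ expPartial i x + ℕtoℚ 2 * expTerm i x
    one-step = begin
      expPartial i x + expTerm i x + ℕtoℚ 2 * expTerm (suc i) x
        ≤⟨ +-monoʳ-≤ (expPartial i x + expTerm i x) (expTerm-halves i (ℕP.≤-trans (ℕ.s≤s ℕ.z≤n) (ℕP.m≤n+m 6 t)) 0≤x x≤1) ⟩
      expPartial i x + expTerm i x + expTerm i x
        ≡⟨ solve 2 (λ a b → a :+ b :+ b := a :+ con (ℕtoℚ 2) :* b) refl (expPartial i x) (expTerm i x) ⟩
      expPartial i x + ℕtoℚ 2 * expTerm i x ∎
      where open ≤-Reasoning

  exp-c69≤2 : ∀ j → expPartial j c69 ≤ ℕtoℚ 2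
  exp-c69≤2 j = begin
    expPartial j c69                                          ≤⟨ expPartial-grows j 6 c69-nonNeg ⟩
    expPartial (6 ℕ.+ j) c69                                  ≡⟨ cong (λ i → expPartial i c69) (ℕP.+-comm 6 j) ⟩
    expPartial (j ℕ.+ 6) c69                                  ≤⟨ ≤-+-nonNeg (*-nonNeg (ℕtoℚ-nonNeg 2)
                                                                                (expTerm-nonNeg (j ℕ.+ 6) c69-nonNeg)) ⟩
    expPartial (j ℕ.+ 6) c69 + ℕtoℚ 2 * expTerm (j ℕ.+ 6) c69 ≤⟨ tail-bound j c69-nonNeg c69≤1 ⟩
    expPartial 6 c69 + ℕtoℚ 2 * expTerm 6 c69                 ≤⟨ exp-c69-certificate ⟩
    ℕtoℚ 2                                                    ∎
    where
    open ≤-Reasoning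
    ≤-+-nonNeg : ∀ {a b} → 0ℚ ≤ b → a ≤ a + b
    ≤-+-nonNeg {a} 0≤b = subst (_≤ a + _) (+-identityʳ a) (+-monoʳ-≤ a 0≤b)

  expPartial-0≤1 : ∀ j → expPartial j 0ℚ ≤ 1ℚ
  expPartial-0≤1 zero    = ≤ᵇ⇒≤ _
  expPartial-0≤1 (suc j) = ≤-reflexive (expPartial-0 j)
    where
    expTerm-0 : ∀ i → expTerm (suc i) 0ℚ ≡ 0ℚ
    expTerm-0 i = trans (cong (_* (+ 1 / suc i)) (*-zeroʳ (expTerm i 0ℚ))) (*-zeroˡ (+ 1 / suc i))
    expPartial-0 : ∀ j → expPartial (suc j) 0ℚ ≡ 1ℚ
    expPartial-0 zero    = refl
    expPartial-0 (suc j) = trans (cong₂ _+_ (expPartial-0 j) (expTerm-0 j)) (+-identityʳ 1ℚ)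

  *-ℕtoℚ-suc : ∀ c k → c * ℕtoℚ (suc k) ≡ c + c * ℕtoℚ k
  *-ℕtoℚ-suc c k = trans (cong (c *_) (ℕtoℚ-suc k)) (trans (*-distribˡ-+ c 1ℚ (ℕtoℚ k)) (cong (_+ c * ℕtoℚ k) (*-identityʳ c)))

  exp-c69k≤2^k : ∀ k j → expPartial j (c69 * ℕtoℚ k) ≤ ℕtoℚ (2 ℕ.^ k)
  exp-c69k≤2^k zero    j = subst (λ q → expPartial j q ≤ 1ℚ) (sym (*-zeroʳ c69)) (expPartial-0≤1 j)
  exp-c69k≤2^k (suc k) j = begin
    expPartial j (c69 * ℕtoℚ (suc k))           ≡⟨ cong (expPartial j) (*-ℕtoℚ-suc c69 k) ⟩
    expPartial j (c69 + c69 * ℕtoℚ k)           ≤⟨ expPartial-submultiplicative j c69-nonNeg c69k-nonNeg ⟩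
    expPartial j c69 * expPartial j (c69 * ℕtoℚ k)
      ≤⟨ *-mono-≤-nonNeg (expPartial-nonNeg j c69-nonNeg) (exp-c69≤2 j)
                         (expPartial-nonNeg j c69k-nonNeg) (exp-c69k≤2^k k j) ⟩
    ℕtoℚ 2 * ℕtoℚ (2 ℕ.^ k)                     ≡⟨ sym (ℕtoℚ-* 2 (2 ℕ.^ k)) ⟩
    ℕtoℚ (2 ℕ.^ suc k)                          ∎
    where
    open ≤-Reasoning
    c69k-nonNeg = *-nonNeg c69-nonNeg (ℕtoℚ-nonNeg k)

  2^k≤exp-c70k : ∀ k → ℕtoℚ (2 ℕ.^ suc k) ≤ expPartial (suc k ℕ.* 6) (c70 * ℕtoℚ (suc k))
  2^k≤exp-c70k zero    = subst (λ q → ℕtoℚ 2 ≤ expPartial 6 q) (sym (*-identityʳ c70)) exp-c70-certificate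
  2^k≤exp-c70k (suc k) = begin
    ℕtoℚ (2 ℕ.^ suc (suc k))                        ≡⟨ ℕtoℚ-* 2 (2 ℕ.^ suc k) ⟩
    ℕtoℚ 2 * ℕtoℚ (2 ℕ.^ suc k)                     ≤⟨ *-mono-≤-nonNeg (ℕtoℚ-nonNeg 2) exp-c70-certificate
                                                                       (ℕtoℚ-nonNeg (2 ℕ.^ suc k)) (2^k≤exp-c70k k) ⟩
    expPartial 6 c70 * expPartial (suc k ℕ.* 6) (c70 * ℕtoℚ (suc k))
      ≤⟨ expPartial-supermultiplicative 6 (suc k ℕ.* 6) c70-nonNeg (*-nonNeg c70-nonNeg (ℕtoℚ-nonNeg (suc k))) ⟩
    expPartial (suc (suc k) ℕ.* 6) (c70 + c70 * ℕtoℚ (suc k)) ≡⟨ cong (expPartial (suc (suc k) ℕ.* 6))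
                                                                      (sym (*-ℕtoℚ-suc c70 (suc k))) ⟩
    expPartial (suc (suc k) ℕ.* 6) (c70 * ℕtoℚ (suc (suc k))) ∎
    where open ≤-Reasoning

  log-lower : ∀ k n → 2 ℕ.^ k ℕ.≤ n → ExpLe (c69 * ℕtoℚ k) n
  log-lower k n 2^k≤n j = ≤-trans (exp-c69k≤2^k k j) (ℕtoℚ-mono-≤ 2^k≤n)

  log-upper : ∀ k n p → n ℕ.< 2 ℕ.^ suc k → ExpLe p n → p ≤ c70 * ℕtoℚ (suc k)
  log-upper k n p n<2^k e^p≤n with p ≤? c70 * ℕtoℚ (suc k)
  ... | yes p≤ = p≤
  ... | no  p≰ = ⊥-elim (<⇒≱ (ℕtoℚ-mono-< n<2^k) (begin
    ℕtoℚ (2 ℕ.^ suc k)                                ≤⟨ 2^k≤exp-c70k k ⟩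
    expPartial (suc k ℕ.* 6) (c70 * ℕtoℚ (suc k))     ≤⟨ expPartial-mono (suc k ℕ.* 6)
                                                            (*-nonNeg c70-nonNeg (ℕtoℚ-nonNeg (suc k))) (<⇒≤ (≰⇒> p≰)) ⟩
    expPartial (suc k ℕ.* 6) p                        ≤⟨ e^p≤n (suc k ℕ.* 6) ⟩
    ℕtoℚ n                                            ∎))
    where open ≤-Reasoning

module Thresholds where

  open import Defs using (ℕtoℚ; LeTenLogSq; LeNOverFiveLog)
  open RationalFacts
  open ExponentialSeries using (expPartial-mono)
  open LogarithmBounds
  open import Data.Nat as ℕ using (ℕ; suc)
  import Data.Nat.Properties as ℕP
  open import Data.Rational
  open import Data.Rational.Properties
  open import Data.Rational.Solver
  open import Data.Empty using (⊥-elim)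
  open import Data.Product using (_,_)
  open import Data.Sum using (inj₁; inj₂)
  open import Relation.Nullary using (yes; no)
  open import Relation.Binary.PropositionalEquality
  open +-*-Solver

  -- If 2^k ≤ n and R ≤ 4.761 k² = 10 (0.69 k)², then R ≤ 10 log² n.
  ≤10log²-criterion : ∀ k n R → 2 ℕ.^ k ℕ.≤ n → 1000 ℕ.* R ℕ.≤ 4761 ℕ.* (k ℕ.* k) → LeTenLogSq n R
  ≤10log²-criterion k n R 2^k≤n 1000R≤ q 0≤q 10q²≤R j =
    ≤-trans (expPartial-mono j 0≤q q≤ℓ) (log-lower k n 2^k≤n j)
    where
    ℓ = c69 * ℕtoℚ k
    R≤10ℓ² : ℕtoℚ R ≤ ℕtoℚ 10 * (ℓ * ℓ)
    R≤10ℓ² = *-cancelˡ-≤-pos (ℕtoℚ 1000) {{ℕtoℚ-suc-positive 999}}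
      (subst₂ _≤_ (ℕtoℚ-* 1000 R)
                  (begin-equality
                     ℕtoℚ (4761 ℕ.* (k ℕ.* k))          ≡⟨ ℕtoℚ-* 4761 (k ℕ.* k) ⟩
                     ℕtoℚ 4761 * ℕtoℚ (k ℕ.* k)         ≡⟨ cong (ℕtoℚ 4761 *_) (ℕtoℚ-* k k) ⟩
                     ℕtoℚ 4761 * (ℕtoℚ k * ℕtoℚ k)      ≡⟨ solve 1 (λ K → con (ℕtoℚ 4761) :* (K :* K)
                                                             := con (ℕtoℚ 1000) :* (con (ℕtoℚ 10)
                                                                  :* ((con c69 :* K) :* (con c69 :* K))))
                                                             refl (ℕtoℚ k) ⟩
                     ℕtoℚ 1000 * (ℕtoℚ 10 * (ℓ * ℓ))    ∎)
                  (ℕtoℚ-mono-≤ 1000R≤))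
      where open ≤-Reasoning
    q≤ℓ : q ≤ ℓ
    q≤ℓ with q ≤? ℓ
    ... | yes q≤ = q≤
    ... | no  q≰ = ⊥-elim (<⇒≱ 10ℓ²<10q² (≤-trans 10q²≤R R≤10ℓ²))
      where
      ℓ<q : ℓ < q
      ℓ<q = ≰⇒> q≰
      instance
        q-positive : Positive q
        q-positive = positive (≤-<-trans (*-nonNeg c69-nonNeg (ℕtoℚ-nonNeg k)) ℓ<q)
      ℓ²<q² : ℓ * ℓ < q * q
      ℓ²<q² = ≤-<-trans (*-monoˡ-≤-nonNeg ℓ {{nonNegative (*-nonNeg c69-nonNeg (ℕtoℚ-nonNeg k))}} (<⇒≤ ℓ<q))
                        (*-monoˡ-<-pos q ℓ<q)
      10ℓ²<10q² : ℕtoℚ 10 * (ℓ * ℓ) < ℕtoℚ 10 * (q * q)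
      10ℓ²<10q² = *-monoʳ-<-pos (ℕtoℚ 10) {{ℕtoℚ-suc-positive 9}} ℓ²<q²

  -- If n < 2^{k+1} and 3.5 (k+1) s ≤ n, then s ≤ n / (5 log n), since log n ≤ 0.7 (k+1).
  ≤n/5log-criterion : ∀ k n s → n ℕ.< 2 ℕ.^ suc k → 7 ℕ.* suc k ℕ.* s ℕ.≤ 2 ℕ.* n → LeNOverFiveLog n s
  ≤n/5log-criterion k n s n<2^k 7[k+1]s≤2n (p , n<5sp , e^p≤n) =
    <⇒≱ (*-monoʳ-<-pos (ℕtoℚ 2) {{ℕtoℚ-suc-positive 1}} n<5sp) (begin
      ℕtoℚ 2 * (ℕtoℚ (5 ℕ.* s) * p)
        ≤⟨ *-monoˡ-≤-nonNeg (ℕtoℚ 2) {{nonNegative (ℕtoℚ-nonNeg 2)}}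
             (*-monoˡ-≤-nonNeg (ℕtoℚ (5 ℕ.* s)) {{nonNegative (ℕtoℚ-nonNeg (5 ℕ.* s))}} (log-upper k n p n<2^k e^p≤n)) ⟩
      ℕtoℚ 2 * (ℕtoℚ (5 ℕ.* s) * (c70 * K))
        ≡⟨ cong (λ z → ℕtoℚ 2 * (z * (c70 * K))) (ℕtoℚ-* 5 s) ⟩
      ℕtoℚ 2 * (ℕtoℚ 5 * ℕtoℚ s * (c70 * K))
        ≡⟨ solve 2 (λ S K → con (ℕtoℚ 2) :* (con (ℕtoℚ 5) :* S :* (con c70 :* K)) := con (ℕtoℚ 7) :* K :* S)
                 refl (ℕtoℚ s) K ⟩
      ℕtoℚ 7 * K * ℕtoℚ s
        ≡⟨ sym (trans (ℕtoℚ-* (7 ℕ.* suc k) s) (cong (_* ℕtoℚ s) (ℕtoℚ-* 7 (suc k)))) ⟩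
      ℕtoℚ (7 ℕ.* suc k ℕ.* s)
        ≤⟨ ℕtoℚ-mono-≤ 7[k+1]s≤2n ⟩
      ℕtoℚ (2 ℕ.* n)
        ≡⟨ ℕtoℚ-* 2 n ⟩
      ℕtoℚ 2 * ℕtoℚ n ∎)
    where
    open ≤-Reasoning
    K = ℕtoℚ (suc k)

  ≤n/5log-mono : ∀ {n s s′} → s ℕ.≤ s′ → LeNOverFiveLog n s′ → LeNOverFiveLog n s
  ≤n/5log-mono {n} {s} {s′} s≤s′ h (p , n<5sp , e^p≤n) with ≤-total 0ℚ p
  ... | inj₁ 0≤p = h (p , <-≤-trans n<5sp (*-monoʳ-≤-nonNeg p {{nonNegative 0≤p}} (ℕtoℚ-mono-≤ (ℕP.*-monoʳ-≤ 5 s≤s′))) , e^p≤n)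
  ... | inj₂ p≤0 = <⇒≱ n<5sp
        (≤-trans (*-monoˡ-≤-nonNeg (ℕtoℚ (5 ℕ.* s)) {{nonNegative (ℕtoℚ-nonNeg (5 ℕ.* s))}} p≤0)
                 (subst (_≤ ℕtoℚ n) (sym (*-zeroʳ (ℕtoℚ (5 ℕ.* s)))) (ℕtoℚ-nonNeg n)))

  ≤n/5log-zero : ∀ n → LeNOverFiveLog n 0
  ≤n/5log-zero n (p , n<0 , _) = <⇒≱ n<0 (subst (_≤ ℕtoℚ n) (sym (*-zeroˡ p)) (ℕtoℚ-nonNeg n))

module Balls where

  open import Defs hiding (sym)
  open import Data.Nat as ℕ using (ℕ; zero; suc)
  import Data.Nat.Properties as ℕP
  open import Data.Bool using (Bool; true; false; _∧_)
  open import Data.Bool.Properties using (∧-conicalˡ; ∧-conicalʳ)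
  open import Data.Fin using (Fin; zero; suc)
  open import Data.Vec using ([]; _∷_; tabulate; here; there)
  import Data.Vec.Properties as VP
  open import Data.Fin.Subset using (Subset; _∈_; _⊆_; _∪_; _─_; ∣_∣)
  import Data.Fin.Subset.Properties as SP
  open import Data.Product using (Σ; _,_; _×_)
  open import Data.Sum using (_⊎_; inj₁; inj₂)
  open import Data.Empty using (⊥; ⊥-elim)
  open import Relation.Binary.PropositionalEquality

  ∈-tabulate⁻ : ∀ {n} {x : Fin n} {f} → x ∈ tabulate f → f x ≡ true
  ∈-tabulate⁻ {x = x} {f} x∈ = trans (sym (VP.lookup∘tabulate f x)) (VP.[]=⇒lookup x∈)

  ∈-tabulate⁺ : ∀ {n} {x : Fin n} {f} → f x ≡ true → x ∈ tabulate f
  ∈-tabulate⁺ {x = x} {f} fx = VP.lookup⇒[]= x (tabulate f) (trans (VP.lookup∘tabulate f x) fx)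

  everything : ∀ n → Subset n
  everything n = tabulate (λ _ → true)

  ∈-everything : ∀ {n} (x : Fin n) → x ∈ everything n
  ∈-everything x = ∈-tabulate⁺ refl

  ∣∪∣-disjoint : ∀ {n} (A B : Subset n) → (∀ x → x ∈ A → x ∈ B → ⊥) → ∣ A ∪ B ∣ ≡ ∣ A ∣ ℕ.+ ∣ B ∣
  ∣∪∣-disjoint []          []          _  = refl
  ∣∪∣-disjoint (true ∷ A)  (true ∷ B)  dj = ⊥-elim (dj zero here here)
  ∣∪∣-disjoint (true ∷ A)  (false ∷ B) dj = cong suc (∣∪∣-disjoint A B (λ x a b → dj (suc x) (there a) (there b)))
  ∣∪∣-disjoint (false ∷ A) (true ∷ B)  dj =
    trans (cong suc (∣∪∣-disjoint A B (λ x a b → dj (suc x) (there a) (there b)))) (sym (ℕP.+-suc ∣ A ∣ ∣ B ∣))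
  ∣∪∣-disjoint (false ∷ A) (false ∷ B) dj = ∣∪∣-disjoint A B (λ x a b → dj (suc x) (there a) (there b))

  ∣─∣-split : ∀ {n} (A B : Subset n) → A ⊆ B → ∣ B ∣ ≡ ∣ A ∣ ℕ.+ ∣ B ─ A ∣
  ∣─∣-split []          []          _   = refl
  ∣─∣-split (true ∷ A)  (true ∷ B)  A⊆B = cong suc (∣─∣-split A B (SP.drop-∷-⊆ A⊆B))
  ∣─∣-split (true ∷ A)  (false ∷ B) A⊆B with A⊆B here
  ... | ()
  ∣─∣-split (false ∷ A) (true ∷ B)  A⊆B =
    trans (cong suc (∣─∣-split A B (SP.drop-∷-⊆ A⊆B))) (sym (ℕP.+-suc ∣ A ∣ ∣ B ─ A ∣))
  ∣─∣-split (false ∷ A) (false ∷ B) A⊆B = ∣─∣-split A B (SP.drop-∷-⊆ A⊆B)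

  ∧-true⁻ : ∀ {a b} → a ∧ b ≡ true → a ≡ true × b ≡ true
  ∧-true⁻ ab = ∧-conicalˡ _ _ ab , ∧-conicalʳ _ _ ab

  anyV⁻ : ∀ {n} (f : Fin n → Bool) → anyV f ≡ true → Σ (Fin n) λ u → f u ≡ true
  anyV⁻ {zero}  f ()
  anyV⁻ {suc n} f any with f zero in fzero
  ... | true  = zero , fzero
  ... | false with anyV⁻ (λ u → f (suc u)) any
  ...   | u , fu = suc u , fu

  anyV⁺ : ∀ {n} (f : Fin n → Bool) (u : Fin n) → f u ≡ true → anyV f ≡ true
  anyV⁺ {suc n} f zero    fu rewrite fu = refl
  anyV⁺ {suc n} f (suc u) fu with f zero
  ... | true  = refl
  ... | false = anyV⁺ (λ v → f (suc v)) u fu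

  module _ {n} (G : Graph n) where

    Adj : Fin n → Fin n → Set
    Adj u v = adj G u v ≡ true

    step-old : ∀ {D A y} → y ∈ A → y ∈ step G D A
    step-old = SP.p⊆p∪q _

    step-new : ∀ {D A y u} → y ∈ D → u ∈ A → Adj u y → y ∈ step G D A
    step-new {D} {A} {y} {u} y∈D u∈A uy =
      SP.q⊆p∪q A _ (∈-tabulate⁺ (cong₂ _∧_ (VP.[]=⇒lookup y∈D)
                                            (anyV⁺ _ u (cong₂ _∧_ (VP.[]=⇒lookup u∈A) uy))))

    step-elim : ∀ {D A y} → y ∈ step G D A → y ∈ A ⊎ (y ∈ D × Σ (Fin n) λ u → u ∈ A × Adj u y)
    step-elim {D} {A} {y} y∈ with SP.x∈p∪q⁻ A _ y∈
    ... | inj₁ y∈A = inj₁ y∈A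
    ... | inj₂ y∈new with ∧-true⁻ (∈-tabulate⁻ y∈new)
    ...   | y∈D , any with anyV⁻ _ any
    ...     | u , u∈A∧uy with ∧-true⁻ u∈A∧uy
    ...       | u∈A , uy = inj₂ (VP.lookup⇒[]= y D y∈D , u , VP.lookup⇒[]= u A u∈A , uy)

    centre∈ball : ∀ {D} r x → x ∈ ballIn G D r x
    centre∈ball zero    x = SP.x∈⁅x⁆ x
    centre∈ball {D} (suc r) x = step-old {D} (centre∈ball r x)

    ball-grows : ∀ {D} r t {x y} → y ∈ ballIn G D r x → y ∈ ballIn G D (t ℕ.+ r) x
    ball-grows r zero    y∈ = y∈
    ball-grows {D} r (suc t) y∈ = step-old {D} (ball-grows r t y∈)

    ball-mono-domain : ∀ {D D′} r {x y} → D ⊆ D′ → y ∈ ballIn G D r x → y ∈ ballIn G D′ r x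
    ball-mono-domain zero    D⊆D′ y∈ = y∈
    ball-mono-domain {D} {D′} (suc r) D⊆D′ y∈ with step-elim {D} y∈
    ... | inj₁ y∈B                   = step-old {D′} (ball-mono-domain r D⊆D′ y∈B)
    ... | inj₂ (y∈D , u , u∈B , uy) = step-new {D′} (D⊆D′ y∈D) (ball-mono-domain r D⊆D′ u∈B) uy

    ballIn⊆ball : ∀ {D} r {x} → ballIn G D r x ⊆ ball G r x
    ballIn⊆ball r = ball-mono-domain r (λ {x} _ → ∈-everything x)

    ball⊆domain : ∀ {D} r {x y} → x ∈ D → y ∈ ballIn G D r x → y ∈ D
    ball⊆domain zero    x∈D y∈ rewrite SP.x∈⁅y⁆⇒x≡y _ y∈ = x∈D
    ball⊆domain {D} (suc r) x∈D y∈ with step-elim {D} y∈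
    ... | inj₁ y∈B       = ball⊆domain r x∈D y∈B
    ... | inj₂ (y∈D , _) = y∈D

    ball⊆closed : ∀ {D T} r {x} → x ∈ T → (∀ w y → w ∈ T → y ∈ D → Adj w y → y ∈ T) → ballIn G D r x ⊆ T
    ball⊆closed zero    x∈T closed y∈ rewrite SP.x∈⁅y⁆⇒x≡y _ y∈ = x∈T
    ball⊆closed {D} (suc r) x∈T closed y∈ with step-elim {D} y∈
    ... | inj₁ y∈B                   = ball⊆closed r x∈T closed y∈B
    ... | inj₂ (y∈D , u , u∈B , uy) = closed u _ (ball⊆closed r x∈T closed u∈B) y∈D uy

module BallGrowth where

  open import Defs hiding (sym)
  open Balls
  open import Data.Nat as ℕ using (ℕ; zero; suc; _+_; _*_; _≤_; _<_; _^_)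
  import Data.Nat.Properties as ℕP
  open import Data.Fin using (Fin)
  open import Data.Fin.Subset using (Subset; _─_; ∣_∣)
  import Data.Fin.Subset.Properties as SP
  open import Data.Product using (Σ; _,_; _×_)
  open import Data.Empty using (⊥-elim)
  open import Relation.Nullary using (yes; no)
  open import Relation.Binary.PropositionalEquality
  open import Data.Nat.Solver
  open +-*-Solver

  module _ {n} (G : Graph n) (H : Subset n) (x : Fin n) where

    B : ℕ → Subset n
    B r = ballIn G H r x

    b : ℕ → ℕ
    b r = ∣ B r ∣

    sphere : ℕ → ℕ
    sphere r = ∣ B (suc r) ─ B r ∣

    b-suc : ∀ r → b (suc r) ≡ b r + sphere r
    b-suc r = ∣─∣-split (B r) (B (suc r)) (step-old G {H})

    b-grows : ∀ t r → b r ≤ b (t + r)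
    b-grows t r = SP.p⊆q⇒∣p∣≤∣q∣ (ball-grows G r t)

    -- Then the ball
    -- size is multiplied by at least 1 + bb/a per step, hence doubles over every m steps
    -- when m·bb ≥ a, and after d·m ≤ R steps it exceeds 2^d.
    module ThickSpheres (R a bb m : ℕ) (2a≤a+m·bb : 2 * a ≤ a + m * bb) (a>0 : 0 < a)
                        (thick : ∀ r → r < R → bb * b r < a * sphere r) where

      linear-growth : ∀ t r → t + r ≤ R → (a + t * bb) * b r ≤ a * b (t + r)
      linear-growth zero    r _ = ℕP.≤-reflexive (cong (_* b r) (ℕP.+-identityʳ a))
      linear-growth (suc t) r t+r<R = begin
        (a + (bb + t * bb)) * b r        ≡⟨ solve 4 (λ a bb t br → (a :+ (bb :+ t :* bb)) :* br
                                                               := (a :+ t :* bb) :* br :+ bb :* br) refl a bb t (b r) ⟩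
        (a + t * bb) * b r + bb * b r    ≤⟨ ℕP.+-mono-≤ (linear-growth t r (ℕP.≤-trans (ℕP.n≤1+n _) t+r<R))
                                                        (ℕP.*-monoʳ-≤ bb (b-grows t r)) ⟩
        a * b (t + r) + bb * b (t + r)   ≤⟨ ℕP.+-monoʳ-≤ (a * b (t + r)) (ℕP.<⇒≤ (thick (t + r) t+r<R)) ⟩
        a * b (t + r) + a * sphere (t + r) ≡⟨ sym (ℕP.*-distribˡ-+ a (b (t + r)) (sphere (t + r))) ⟩
        a * (b (t + r) + sphere (t + r)) ≡⟨ cong (a *_) (sym (b-suc (t + r))) ⟩
        a * b (suc t + r)                ∎
        where open ℕP.≤-Reasoning

      doubling : ∀ r → m + r ≤ R → 2 * b r ≤ b (m + r)
      doubling r m+r≤R = ℕP.*-cancelˡ-≤ a {{ℕ.>-nonZero a>0}} (begin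
        a * (2 * b r)      ≡⟨ solve 2 (λ a br → a :* (con 2 :* br) := (con 2 :* a) :* br) refl a (b r) ⟩
        (2 * a) * b r      ≤⟨ ℕP.*-monoˡ-≤ (b r) 2a≤a+m·bb ⟩
        (a + m * bb) * b r ≤⟨ linear-growth m r m+r≤R ⟩
        a * b (m + r)      ∎)
        where open ℕP.≤-Reasoning

      exponential-growth : ∀ d → d * m ≤ R → 2 ^ d ≤ b (d * m)
      exponential-growth zero    _      = ℕP.≤-reflexive (sym (SP.∣⁅x⁆∣≡1 x))
      exponential-growth (suc d) dm+m≤R =
        ℕP.≤-trans (ℕP.*-monoʳ-≤ 2 (exponential-growth d (ℕP.≤-trans (ℕP.m≤n+m (d * m) m) dm+m≤R)))
                   (doubling (d * m) dm+m≤R)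

    thin-sphere : ∀ (R a bb m d : ℕ) → 2 * a ≤ a + m * bb → 0 < a → d * m ≤ R → n < 2 ^ d →
                  Σ ℕ λ r → r ≤ R × a * sphere r ≤ bb * b r
    thin-sphere R a bb m d 2a≤a+m·bb a>0 dm≤R n<2^d
      with ℕP.anyUpTo? (λ r → a * sphere r ℕP.≤? bb * b r) R
    ... | yes (r , r<R , thin) = r , ℕP.<⇒≤ r<R , thin
    ... | no  none = ⊥-elim (ℕP.<⇒≱ n<2^d (ℕP.≤-trans (exponential-growth d dm≤R) (SP.∣p∣≤n (B (d * m)))))
      where
      thick : ∀ r → r < R → bb * b r < a * sphere r
      thick r r<R = ℕP.≰⇒> (λ thin → none (r , r<R , thin))
      open ThickSpheres R a bb m 2a≤a+m·bb a>0 thick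

module Greedy where

  open import Defs hiding (sym)
  open Balls
  open BallGrowth using (b; sphere)
  open import Data.Nat as ℕ using (ℕ; _+_; _*_; _≤_)
  import Data.Nat.Properties as ℕP
  open import Data.Fin using (Fin)
  import Data.Fin.Subset as SS
  open import Data.Fin.Subset using (Subset; _∈_; _∉_; _⊆_; _∪_; _─_; ∁; ∣_∣)
  import Data.Fin.Subset.Properties as SP
  open import Data.Product using (Σ; _,_; _×_; proj₁; proj₂)
  open import Data.Sum using (inj₁; inj₂)
  open import Data.Empty using (⊥-elim)
  open import Data.List using (List; []; _∷_; allFin)
  import Data.List.Membership.Propositional as List
  open import Data.List.Membership.Propositional.Properties using (∈-allFin)
  open import Data.List.Relation.Unary.Any using (here; there)
  open import Relation.Nullary using (yes; no)
  open import Relation.Binary.PropositionalEquality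

  -- Given that every ball in every remaining vertex set H has a thin
  -- sphere at some radius r ≤ R (a · |sphere| ≤ bb · |ball|), repeatedly take such a ball
  -- around an uncovered vertex in the uncovered part, put its sphere into S and mark the
  -- ball covered.  The spheres pay for themselves: a |S| ≤ bb |covered| ≤ bb n.
  module _ {n} (G : Graph n) (R a bb : ℕ)
    (thin : ∀ (H : Subset n) x →
            Σ ℕ λ r → r ≤ R × a * sphere G H x r ≤ bb * b G H x r) where

    Closed : Subset n → Subset n → Set
    Closed S T = ∀ w y → w ∈ T → y ∉ S → Adj G w y → y ∈ T

    Piece : Subset n → Subset n → Fin n → Set
    Piece U S u = Σ (Subset n) λ T → u ∈ T × T ⊆ U × Closed S T ×
                    Σ ℕ λ r → Σ (Fin n) λ x → r ≤ R × T ⊆ ball G r x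

    record Invariant (U S : Subset n) : Set where
      field
        S⊆U    : S ⊆ U
        paid   : a * ∣ S ∣ ≤ bb * ∣ U ∣
        pieces : ∀ u → u ∈ U → u ∉ S → Piece U S u
    open Invariant

    State : Set
    State = Σ (Subset n) λ U → Σ (Subset n) λ S → Invariant U S

    covered : State → Subset n
    covered = proj₁

    module Step (U S : Subset n) (inv : Invariant U S) (v : Fin n) (v∉U : v ∉ U) where
      H = ∁ U
      v∈H = SP.x∉p⇒x∈∁p v∉U
      thin-v = thin H v
      r  = proj₁ thin-v
      B  = ballIn G H r v
      B′ = ballIn G H (ℕ.suc r) v
      σ  = B′ ─ B
      U′ = U ∪ B′
      S′ = S ∪ σ

      B⊆B′ : B ⊆ B′
      B⊆B′ = step-old G {H}

      S⊆S′ : S ⊆ S′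
      S⊆S′ = SP.p⊆p∪q σ

      B′-fresh : ∀ {y} → y ∈ B′ → y ∉ U
      B′-fresh y∈ = SP.x∈∁p⇒x∉p (ball⊆domain G (ℕ.suc r) v∈H y∈)

      S′⊆U′ : S′ ⊆ U′
      S′⊆U′ y∈ with SP.x∈p∪q⁻ S σ y∈
      ... | inj₁ y∈S = SP.p⊆p∪q B′ (S⊆U inv y∈S)
      ... | inj₂ y∈σ = SP.q⊆p∪q U B′ (SP.p─q⊆p B′ B y∈σ)

      paid′ : a * ∣ S′ ∣ ≤ bb * ∣ U′ ∣
      paid′ = begin
        a * ∣ S′ ∣               ≡⟨ cong (a *_) (∣∪∣-disjoint S σ (λ _ y∈S y∈σ →
                                       B′-fresh (SP.p─q⊆p B′ B y∈σ) (S⊆U inv y∈S))) ⟩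
        a * (∣ S ∣ + ∣ σ ∣)      ≡⟨ ℕP.*-distribˡ-+ a ∣ S ∣ ∣ σ ∣ ⟩
        a * ∣ S ∣ + a * ∣ σ ∣    ≤⟨ ℕP.+-mono-≤ (paid inv) (proj₂ (proj₂ thin-v)) ⟩
        bb * ∣ U ∣ + bb * ∣ B ∣  ≤⟨ ℕP.+-monoʳ-≤ (bb * ∣ U ∣) (ℕP.*-monoʳ-≤ bb (SP.p⊆q⇒∣p∣≤∣q∣ B⊆B′)) ⟩
        bb * ∣ U ∣ + bb * ∣ B′ ∣ ≡⟨ sym (ℕP.*-distribˡ-+ bb ∣ U ∣ ∣ B′ ∣) ⟩
        bb * (∣ U ∣ + ∣ B′ ∣)    ≡⟨ cong (bb *_) (sym (∣∪∣-disjoint U B′ (λ _ y∈U y∈B′ → B′-fresh y∈B′ y∈U))) ⟩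
        bb * ∣ U′ ∣              ∎
        where open ℕP.≤-Reasoning

      -- If y were
      -- covered, the closed piece of y would swallow the fresh vertex w; otherwise y ∈ B′,
      -- and y ∉ σ forces y ∈ B.
      B-closed : Closed S′ B
      B-closed w y w∈B y∉S′ wy with y SP.∈? U
      ... | yes y∈U =
        let (T , y∈T , T⊆U , T-closed , _) = pieces inv y y∈U (λ y∈S → y∉S′ (S⊆S′ y∈S))
            w∉S = λ w∈S → B′-fresh (B⊆B′ w∈B) (S⊆U inv w∈S)
        in ⊥-elim (B′-fresh (B⊆B′ w∈B) (T⊆U (T-closed y w y∈T w∉S (trans (Graph.sym G y w) wy))))
      ... | no y∉U with y SP.∈? B
      ...   | yes y∈B = y∈B
      ...   | no  y∉B = ⊥-elim (y∉S′ (SP.q⊆p∪q S σ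
                          (SP.x∈p∧x∉q⇒x∈p─q (step-new G {H} (SP.x∉p⇒x∈∁p y∉U) w∈B wy) y∉B)))

      -- Old pieces survive (S grows, U grows); new vertices lie in the piece B.
      pieces′ : ∀ u → u ∈ U′ → u ∉ S′ → Piece U′ S′ u
      pieces′ u u∈U′ u∉S′ with SP.x∈p∪q⁻ U B′ u∈U′
      ... | inj₁ u∈U =
        let (T , u∈T , T⊆U , T-closed , in-ball) = pieces inv u u∈U (λ u∈S → u∉S′ (S⊆S′ u∈S))
        in T , u∈T , (λ t∈T → SP.p⊆p∪q B′ (T⊆U t∈T)) ,
           (λ w y w∈T y∉S′ → T-closed w y w∈T (λ y∈S → y∉S′ (S⊆S′ y∈S))) , in-ball
      ... | inj₂ u∈B′ with u SP.∈? B
      ...   | yes u∈B = B , u∈B , (λ t∈B → SP.q⊆p∪q U B′ (B⊆B′ t∈B)) , B-closed ,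
                        r , v , proj₁ (proj₂ thin-v) , ballIn⊆ball G r
      ...   | no  u∉B = ⊥-elim (u∉S′ (SP.q⊆p∪q S σ (SP.x∈p∧x∉q⇒x∈p─q u∈B′ u∉B)))

      invariant′ : Invariant U′ S′
      invariant′ = record { S⊆U = S′⊆U′ ; paid = paid′ ; pieces = pieces′ }

    cover-vertex : ∀ v (st : State) → Σ State λ st′ → covered st ⊆ covered st′ × v ∈ covered st′
    cover-vertex v st@(U , S , inv) with v SP.∈? U
    ... | yes v∈U = st , (λ u∈ → u∈) , v∈U
    ... | no  v∉U = (U′ , S′ , invariant′) , SP.p⊆p∪q B′ , SP.q⊆p∪q U B′ (centre∈ball G (ℕ.suc r) v)
      where open Step U S inv v v∉U

    cover-list : (L : List (Fin n)) (st : State) →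
                 Σ State λ st′ → covered st ⊆ covered st′ × (∀ v → v List.∈ L → v ∈ covered st′)
    cover-list []      st = st , (λ u∈ → u∈) , (λ _ ())
    cover-list (v ∷ L) st =
      let (st₁ , st⊆st₁ , v∈st₁) = cover-vertex v st
          (st₂ , st₁⊆st₂ , L⊆st₂) = cover-list L st₁
      in st₂ , (λ u∈ → st₁⊆st₂ (st⊆st₁ u∈)) ,
         λ { w (here refl) → st₁⊆st₂ v∈st₁ ; w (there w∈L) → L⊆st₂ w w∈L }

    empty : State
    empty = SS.⊥ , SS.⊥ , record
      { S⊆U    = λ u∈ → u∈
      ; paid   = subst (λ z → a * z ≤ bb * z) (sym (SP.∣⊥∣≡0 n)) (ℕP.≤-reflexive (trans (ℕP.*-zeroʳ a) (sym (ℕP.*-zeroʳ bb))))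
      ; pieces = λ _ u∈⊥ → ⊥-elim (SP.∉⊥ u∈⊥)
      }

    greedy-separator : Σ (Subset n) λ S → (a * ∣ S ∣ ≤ bb * n) ×
      (∀ v → v ∉ S → Σ ℕ λ r → Σ (Fin n) λ x → r ≤ R × component G S v ⊆ ball G r x)
    greedy-separator =
      let ((U , S , inv) , _ , all-covered) = cover-list (allFin n) empty
      in S , ℕP.≤-trans (paid inv) (ℕP.*-monoʳ-≤ bb (SP.∣p∣≤n U)) , λ v v∉S →
         let (T , v∈T , _ , T-closed , r , x , r≤R , T⊆ball) = pieces inv v (all-covered v (∈-allFin v)) v∉S
         in r , x , r≤R , λ y∈ → T⊆ball (ball⊆closed G n v∈T
                                    (λ w y w∈T y∈∁S → T-closed w y w∈T (SP.x∈∁p⇒x∉p y∈∁S)) y∈)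

open import Defs hiding (sym)
open Balls
open BallGrowth using (thin-sphere)
open Greedy using (greedy-separator)
open Thresholds
open import Data.Nat as ℕ using (ℕ; zero; suc; _+_; _*_; _≤_; _<_; _^_; _⊔_)
import Data.Nat.Properties as ℕP
open import Data.Fin using (Fin)
import Data.Fin.Subset as SS
open import Data.Fin.Subset using (Subset; ∣_∣; _∉_)
import Data.Fin.Subset.Properties as SP
open import Data.Product using (Σ; _,_; _×_)
open import Data.Empty using (⊥-elim)
open import Data.Unit using (tt)
open import Relation.Nullary using (¬_; yes; no; ¬?)
open import Relation.Nullary.Decidable using (toWitness)
open import Relation.Binary.PropositionalEquality
open import Data.Nat.Solver
open +-*-Solver

dyadic : ∀ n → 1 ≤ n → Σ ℕ λ k → 2 ^ k ≤ n × n < 2 ^ suc k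
dyadic (suc zero)    _ = 0 , ℕP.≤-refl , ℕP.≤-refl
dyadic (suc (suc m)) _ with dyadic (suc m) (ℕ.s≤s ℕ.z≤n)
... | k , 2^k≤m+1 , m+1<2^k+1 with suc (suc m) ℕP.<? 2 ^ suc k
...   | yes m+2<2^k+1 = k , ℕP.≤-trans 2^k≤m+1 (ℕP.n≤1+n _) , m+2<2^k+1
...   | no  m+2≮2^k+1 = suc k , ℕP.≤-reflexive (sym m+2≡2^k+1) , m+2<2^k+2
  where
  open ℕP.≤-Reasoning
  m+2≡2^k+1 : suc (suc m) ≡ 2 ^ suc k
  m+2≡2^k+1 = ℕP.≤-antisym m+1<2^k+1 (ℕP.≮⇒≥ m+2≮2^k+1)
  m+2<2^k+2 : suc (suc m) < 2 ^ suc (suc k)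
  m+2<2^k+2 = begin-strict
    suc (suc m)              ≡⟨ m+2≡2^k+1 ⟩
    2 ^ suc k                <⟨ ℕP.m<m+n (2 ^ suc k) (ℕP.m^n>0 2 (suc k)) ⟩
    2 ^ suc k + 2 ^ suc k    ≡⟨ cong (2 ^ suc k +_) (sym (ℕP.+-identityʳ (2 ^ suc k))) ⟩
    2 ^ suc (suc k)          ∎

no-small-k : ∀ {k} → k < 7 → ¬ (2 ⊔ suc (4 * (k * k)) < 2 ^ suc k)
no-small-k = toWitness {a? = ℕP.allUpTo? (λ k → ¬? (2 ⊔ suc (4 * (k * k)) ℕP.<? 2 ^ suc k)) 7} tt

7≤k : ∀ k n → 2 ≤ n → 4 * (k * k) < n → n < 2 ^ suc k → 7 ≤ k
7≤k k n 2≤n 4k²<n n<2^k+1 with k ℕP.<? 7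
... | yes k<7 = ⊥-elim (no-small-k k<7 (ℕP.≤-<-trans (ℕP.⊔-lub 2≤n 4k²<n) n<2^k+1))
... | no  k≮7 = ℕP.≮⇒≥ k≮7

SmallBalls : ∀ {n} → Graph n → Set
SmallBalls {n} G = ∀ (r : ℕ) (x : Fin n) → LeTenLogSq n r → LeNOverFiveLog n ∣ ball G r x ∣

Separator : ∀ {n} → Graph n → Set
Separator {n} G = Σ (Subset n) λ S → LeNOverFiveLog n ∣ S ∣
                    × (∀ (v : Fin n) → v ∉ S → LeNOverFiveLog n ∣ component G S v ∣)

component-in-small-ball : ∀ {n} (G : Graph n) → SmallBalls G → ∀ S v r x → LeTenLogSq n r →
  SS._⊆_ (component G S v) (ball G r x) → LeNOverFiveLog n ∣ component G S v ∣
component-in-small-ball {n} G small S v r x r≤10log² comp⊆ball =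
  ≤n/5log-mono {n} (SP.p⊆q⇒∣p∣≤∣q∣ comp⊆ball) (small r x r≤10log²)

-- Few vertices (n ≤ 4k² ≤ 10 log² n): S = ∅ works, as each component lies in the ball of radius n.
few-vertices : ∀ n (G : Graph n) k → 2 ^ k ≤ n → n ≤ 4 * (k * k) → SmallBalls G → Separator G
few-vertices n G k 2^k≤n n≤4k² small =
  SS.⊥ , subst (LeNOverFiveLog n) (sym (SP.∣⊥∣≡0 n)) (≤n/5log-zero n) , λ v _ →
  component-in-small-ball G small SS.⊥ v n v (≤10log²-criterion k n n 2^k≤n 1000n≤4761k²)
    (ballIn⊆ball G n)
  where
  1000n≤4761k² : 1000 * n ≤ 4761 * (k * k)
  1000n≤4761k² = begin
    1000 * n           ≤⟨ ℕP.*-monoʳ-≤ 1000 n≤4k² ⟩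
    1000 * (4 * (k * k)) ≡⟨ solve 1 (λ K → con 1000 :* (con 4 :* K) := con 4000 :* K) refl (k * k) ⟩
    4000 * (k * k)     ≤⟨ ℕP.*-monoˡ-≤ (k * k) (toWitness {a? = 4000 ℕP.≤? 4761} tt) ⟩
    4761 * (k * k)     ∎
    where open ℕP.≤-Reasoning

-- Balls double every m = 4k steps, so d = k+1 doublings
-- fit into R and overflow n < 2^{k+1}.
module ManyVertices (k : ℕ) (7≤k : 7 ≤ k) where
  R a m : ℕ
  R = 4 * (k * k) + 4 * k
  a = 7 * suc k
  m = 4 * k

  2a≤a+2m : 2 * a ≤ a + m * 2
  2a≤a+2m = begin
    2 * a                      ≡⟨ solve 1 (λ k → con 2 :* (con 7 :* (con 1 :+ k))
                                             := con 7 :* (con 1 :+ k) :+ (con 7 :+ con 7 :* k)) refl k ⟩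
    a + (7 + 7 * k)            ≤⟨ ℕP.+-monoʳ-≤ a (ℕP.+-monoˡ-≤ (7 * k) 7≤k) ⟩
    a + (k + 7 * k)            ≡⟨ solve 1 (λ k → con 7 :* (con 1 :+ k) :+ (k :+ con 7 :* k)
                                             := con 7 :* (con 1 :+ k) :+ con 4 :* k :* con 2) refl k ⟩
    a + m * 2                  ∎
    where open ℕP.≤-Reasoning

  [k+1]m≡R : suc k * m ≡ R
  [k+1]m≡R = solve 1 (λ k → (con 1 :+ k) :* (con 4 :* k) := con 4 :* (k :* k) :+ con 4 :* k) refl k

  1000R≤4761k² : 1000 * R ≤ 4761 * (k * k)
  1000R≤4761k² = begin
    1000 * R                            ≡⟨ solve 1 (λ k → con 1000 :* (con 4 :* (k :* k) :+ con 4 :* k)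
                                                      := con 4000 :* (k :* k) :+ con 4000 :* k) refl k ⟩
    4000 * (k * k) + 4000 * k           ≤⟨ ℕP.+-monoʳ-≤ (4000 * (k * k)) (ℕP.*-monoˡ-≤ k 4000≤761k) ⟩
    4000 * (k * k) + 761 * k * k        ≡⟨ solve 1 (λ k → con 4000 :* (k :* k) :+ con 761 :* k :* k
                                                      := con 4761 :* (k :* k)) refl k ⟩
    4761 * (k * k)                      ∎
    where
    open ℕP.≤-Reasoning
    4000≤761k : 4000 ≤ 761 * k
    4000≤761k = ℕP.≤-trans (toWitness {a? = 4000 ℕP.≤? 761 * 7} tt) (ℕP.*-monoʳ-≤ 761 7≤k)

  many-vertices : ∀ n (G : Graph n) → 2 ^ k ≤ n → n < 2 ^ suc k → SmallBalls G → Separator G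
  many-vertices n G 2^k≤n n<2^k+1 small =
    let (S , a∣S∣≤2n , comps) = greedy-separator G R a 2 λ H x →
          thin-sphere G H x R a 2 m (suc k) 2a≤a+2m (ℕ.s≤s ℕ.z≤n) (ℕP.≤-reflexive [k+1]m≡R) n<2^k+1
    in S , ≤n/5log-criterion k n ∣ S ∣ n<2^k+1 a∣S∣≤2n , λ v v∉S →
       let (r , x , r≤R , comp⊆ball) = comps v v∉S
       in component-in-small-ball G small S v r x
            (≤10log²-criterion k n r 2^k≤n (ℕP.≤-trans (ℕP.*-monoʳ-≤ 1000 r≤R) 1000R≤4761k²)) comp⊆ball

lemma3p2 : (n : ℕ) → 2 ≤ n → (G : Graph n)
    → (∀ (r : ℕ) (x : Fin n) → LeTenLogSq n r → LeNOverFiveLog n ∣ ball G r x ∣)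
    → Σ (Subset n) λ S → LeNOverFiveLog n ∣ S ∣
    × (∀ (v : Fin n) → v ∉ S → LeNOverFiveLog n ∣ component G S v ∣)
lemma3p2 n 2≤n G small with dyadic n (ℕP.≤-trans (ℕ.s≤s ℕ.z≤n) 2≤n)
... | k , 2^k≤n , n<2^k+1 with n ℕP.≤? 4 * (k * k)
...   | yes n≤4k² = few-vertices n G k 2^k≤n n≤4k² small
...   | no  n≰4k² = ManyVertices.many-vertices k (7≤k k n 2≤n (ℕP.≰⇒> n≰4k²) n<2^k+1) n G 2^k≤n n<2^k+1 small
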